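{- Let $M$ be a positive integer and let $(a_1,\dots,a_k)$ be a bad tuple of positive integers with $\sum_{i=1}^k 1/a_i=t$ and $a_i\le 2M$ for all $i$. Then there exists a bad tuple $(b_1,\dots,b_m)$ of positive integers with $\sum_{i=1}^m 1/b_i\ge \frac{M+1}{M+2}t-\frac{1}{M+2}$ and $b_i\le M$ for all $i$.
   Context: A tuple $(a_1,\dots,a_k)$ of positive integers is good if there are sets $S_1,\dots,S_k\subseteq\mathbb{R}$ such that any two distinct elements of $S_i$ differ by at least $a_i$ and every integer belongs to $S_1\cup\dots\cup S_k$; otherwise it is bad. -}

module Defs where

open import Data.Nat as ℕ using (ℕ; _≤_)
open import Data.Integer using (ℤ; _-_; ∣_∣)
open import Data.Fin using (Fin; zero; suc)
open import Data.Product using (Σ; _×_)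
open import Data.Rational using (ℚ; 0ℚ; _+_; _/_)
open import Data.Integer using (+_)
open import Relation.Nullary using (¬_)
open import Relation.Binary.PropositionalEquality using (_≢_)

Separated : ℕ → (ℤ → Set) → Set
Separated d S = ∀ x y → S x → S y → x ≢ y → d ≤ ∣ x - y ∣

Good : {k : ℕ} → (Fin k → ℕ) → Set₁
Good {k} a = Σ (Fin k → ℤ → Set) λ S →
  (∀ i → Separated (a i) (S i)) × (∀ (n : ℤ) → Σ (Fin k) λ i → S i n)

Bad : {k : ℕ} → (Fin k → ℕ) → Set₁
Bad a = ¬ Good a

-- 1/n as a rational (only used for n ≥ 1; 1/0 is set to 0 by convention)
recip : ℕ → ℚ
recip ℕ.zero = 0ℚ
recip (ℕ.suc n) = (+ 1) / ℕ.suc n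

recipSum : {k : ℕ} → (Fin k → ℕ) → ℚ
recipSum {ℕ.zero} a = 0ℚ
recipSum {ℕ.suc k} a = recip (a zero) + recipSum (λ i → a (suc i))

{-# OPTIONS --safe #-}
-- Sort the tuple, keep the entries ≤ M, and replace the entries above M, taken in consecutive
-- pairs (a, b) with a ≤ b, by ⌈b/2⌉ ≤ M; an unpaired last entry is dropped.  If the new tuple
-- were good, so would be the old one: taking every other element of a ⌈b/2⌉-separated set of
-- integers splits it into two b-separated sets.  With θ = (M+1)/(M+2), a pair contributes
-- 1/⌈b/2⌉ ≥ 2θ/b ≥ θ/b + θ/c, where c ≥ b is the entry following the pair; so the new sum pays
-- for θ times the reciprocals of all large entries but the smallest one a₀, and θ/a₀ ≤ 1/(M+2).
module Submission where

open import Data.Nat using (ℕ)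
open import Defs

module Separation where
  open import Data.Bool using (Bool; true; false; not; _∧_; _xor_)
  open import Data.Bool.Properties as Bool using (xor-same; xor-assoc; xor-identityʳ; xor-comm; not-¬)
  open import Data.Empty using (⊥-elim)
  open import Data.Integer using (ℤ; +_; -[1+_]; ∣_∣; _+_; _-_; -_) renaming (suc to sucℤ)
  import Data.Integer.Properties as ℤ
  open import Data.Integer.Solver using (module +-*-Solver)
  open import Data.Nat as ℕ using (zero; suc; _≤_; _<_)
  import Data.Nat.Properties as ℕ
  open import Data.Product using (∃-syntax; _×_; _,_)
  open import Data.Sum using (_⊎_; inj₁; inj₂)
  open import Relation.Nullary using (yes; no; does)
  open import Relation.Nullary.Decidable using (dec-true)
  open import Relation.Binary.PropositionalEquality
  open +-*-Solver

  separated-weaken : ∀ {c d P} → c ≤ d → Separated d P → Separated c P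
  separated-weaken c≤d sep i j pi pj i≢j = ℕ.≤-trans c≤d (sep i j pi pj i≢j)

  ∣i-[i+j]∣≡∣j∣ : ∀ i j → ∣ i - (i + j) ∣ ≡ ∣ j ∣
  ∣i-[i+j]∣≡∣j∣ i j = trans (cong ∣_∣ (i-[i+j]≡-j i j)) (ℤ.∣-i∣≡∣i∣ j)
    where
    i-[i+j]≡-j : ∀ i j → i - (i + j) ≡ - j
    i-[i+j]≡-j = solve 2 (λ i j → i :- (i :+ j) := :- j) refl

  ≢⇒gap : ∀ {i j} → i ≢ j → ∃[ n ] (j ≡ i + + suc n ⊎ i ≡ j + + suc n)
  ≢⇒gap {i} {j} i≢j = split (j - i) (sym (i+[j-i]≡j i j))
    where
    i+[j-i]≡j : ∀ i j → i + (j - i) ≡ j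
    i+[j-i]≡j = solve 2 (λ i j → i :+ (j :- i) := j) refl
    [i+k]-k≡i : ∀ i k → (i + k) + - k ≡ i
    [i+k]-k≡i = solve 2 (λ i k → (i :+ k) :+ :- k := i) refl
    split : ∀ k → j ≡ i + k → ∃[ n ] (j ≡ i + + suc n ⊎ i ≡ j + + suc n)
    split (+ zero)   j≡i+0 = ⊥-elim (i≢j (sym (trans j≡i+0 (ℤ.+-identityʳ i))))
    split (+ suc n)  j≡i+k = n , inj₁ j≡i+k
    split -[1+ n ]   j≡i+k = n , inj₂ (trans (sym ([i+k]-k≡i i -[1+ n ])) (cong (λ x → x + + suc n) (sym j≡i+k)))

  separated⇒≤gap : ∀ {c P} → Separated c P → ∀ {i n} → P i → P (i + + suc n) → c ≤ suc n
  separated⇒≤gap {c} sep {i} {n} pi pj =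
    subst (c ≤_) (∣i-[i+j]∣≡∣j∣ i (+ suc n)) (sep i _ pi pj i≢i+1+n)
    where
    i≢i+1+n : i ≢ i + + suc n
    i≢i+1+n eq = ℕ.0≢1+n (begin
      0                        ≡⟨ cong ∣_∣ (ℤ.+-inverseʳ i) ⟨
      ∣ i - i ∣                ≡⟨ cong (λ k → ∣ i - k ∣) eq ⟩
      ∣ i - (i + + suc n) ∣    ≡⟨ ∣i-[i+j]∣≡∣j∣ i (+ suc n) ⟩
      suc n                    ∎)
      where open ≡-Reasoning

  ≤gap⇒separated : ∀ {c P} → (∀ {i n} → P i → P (i + + suc n) → c ≤ suc n) → Separated c P
  ≤gap⇒separated {c} gap i j pi pj i≢j with ≢⇒gap i≢j
  ... | n , inj₁ refl = subst (c ≤_) (sym (∣i-[i+j]∣≡∣j∣ i (+ suc n))) (gap pi pj)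
  ... | n , inj₂ refl =
    subst (c ≤_) (sym (trans (ℤ.∣i-j∣≡∣j-i∣ _ j) (∣i-[i+j]∣≡∣j∣ j (+ suc n)))) (gap pj pi)

  i+[1+n]≡suc[i+n] : ∀ i n → i + + suc n ≡ sucℤ (i + + n)
  i+[1+n]≡suc[i+n] i n = solve 2 (λ i n → i :+ (con (+ 1) :+ n) := con (+ 1) :+ (i :+ n)) refl i (+ n)

  suc[i]+n≡i+[1+n] : ∀ i n → sucℤ i + + n ≡ i + + suc n
  suc[i]+n≡i+[1+n] i n = solve 2 (λ i n → (con (+ 1) :+ i) :+ n := i :+ (con (+ 1) :+ n)) refl i (+ n)

  module Halving (S : ℤ → Bool) where

    -- the parity of |S ∩ [0, i)|, and of |S ∩ [i, 0)| for negative i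
    parity : ℤ → Bool
    parity (+ zero)       = false
    parity (+ suc n)      = parity (+ n) xor S (+ n)
    parity -[1+ zero ]    = S -[1+ zero ]
    parity -[1+ suc n ]   = parity -[1+ n ] xor S -[1+ suc n ]

    parity-suc : ∀ i → parity (sucℤ i) ≡ parity i xor S i
    parity-suc (+ n)        = refl
    parity-suc -[1+ zero ]  = sym (xor-same (S -[1+ zero ]))
    parity-suc -[1+ suc n ] = sym (begin
      (p xor s) xor s  ≡⟨ xor-assoc p s s ⟩
      p xor (s xor s)  ≡⟨ cong (p xor_) (xor-same s) ⟩
      p xor false      ≡⟨ xor-identityʳ p ⟩
      p                ∎)
      where
      open ≡-Reasoning
      p = parity -[1+ n ]
      s = S -[1+ suc n ]

    parity-change : ∀ i n → parity (i + + n) ≢ parity i → ∃[ j ] j < n × S (i + + j) ≡ true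
    parity-change i zero    changed = ⊥-elim (changed (cong parity (ℤ.+-identityʳ i)))
    parity-change i (suc n) changed with S (i + + n) in s
    ... | true  = n , ℕ.≤-refl , s
    ... | false with parity-change i n (λ same → changed (trans step same))
      where
      step : parity (i + + suc n) ≡ parity (i + + n)
      step = trans (cong parity (i+[1+n]≡suc[i+n] i n))
                   (trans (parity-suc (i + + n)) (trans (cong (parity (i + + n) xor_) s) (xor-identityʳ _)))
    ...   | j , j<n , sj = j , ℕ.m<n⇒m<1+n j<n , sj

    half : Bool → ℤ → Bool
    half b i = S i ∧ does (parity i Bool.≟ b)

    half-sound : ∀ b i → half b i ≡ true → S i ≡ true × parity i ≡ b
    half-sound b i h with S i | parity i Bool.≟ b
    ... | true | yes p = refl , p
    half-sound b i () | true  | no _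
    half-sound b i () | false | _

    halves-cover : ∀ i → half true i ≡ false → half false i ≡ false → S i ≡ false
    halves-cover i h₁ h₀ with S i in s
    ... | false = refl
    ... | true with parity i | dec-true (parity i Bool.≟ parity i) refl
    ...   | true  | h = trans (sym h) h₁
    ...   | false | h = trans (sym h) h₀

    double-gap : ∀ {c} → Separated c (λ i → S i ≡ true) →
                 ∀ {i n} → S i ≡ true → S (i + + suc n) ≡ true → parity i ≡ parity (i + + suc n) →
                 c ℕ.+ c ≤ suc n
    double-gap {c} sep {i} {n} si sn same with parity-change (sucℤ i) n flips
      where
      open ≡-Reasoning
      flips : parity (sucℤ i + + n) ≢ parity (sucℤ i)
      flips changed = not-¬ refl (begin
        parity i                  ≡⟨ same ⟩
        parity (i + + suc n)      ≡⟨ cong parity (suc[i]+n≡i+[1+n] i n) ⟨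
        parity (sucℤ i + + n)     ≡⟨ changed ⟩
        parity (sucℤ i)           ≡⟨ parity-suc i ⟩
        parity i xor S i          ≡⟨ cong (parity i xor_) si ⟩
        parity i xor true         ≡⟨ xor-comm (parity i) true ⟩
        not (parity i)            ∎)
    ... | j , j<n , sj with ℕ.m≤n⇒∃[o]m+o≡n j<n
    ...   | k , refl = subst (c ℕ.+ c ≤_) (ℕ.+-suc (suc j) k)
                           (ℕ.+-mono-≤ (separated⇒≤gap sep si sm) (separated⇒≤gap sep sm sn′))
      where
      sm : S (i + + suc j) ≡ true
      sm = subst (λ x → S x ≡ true) (suc[i]+n≡i+[1+n] i j) sj
      sn′ : S ((i + + suc j) + + suc k) ≡ true
      sn′ = subst (λ x → S x ≡ true)
              (sym (trans (ℤ.+-assoc i (+ suc j) (+ suc k)) (cong (λ m → i + + m) (ℕ.+-suc (suc j) k)))) sn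

    half-separated : ∀ {c} → Separated c (λ i → S i ≡ true) →
                     ∀ b → Separated (c ℕ.+ c) (λ i → half b i ≡ true)
    half-separated sep b = ≤gap⇒separated λ {i} hi hn →
      let si , pi = half-sound b i hi
          sn , pn = half-sound b _ hn
      in double-gap sep si sn (trans pi (sym pn))

module Covering where
  open import Data.Bool using (Bool; true; false)
  open import Data.Empty using (⊥-elim)
  open import Data.Fin using (Fin; zero; suc)
  open import Data.Integer using (ℤ)
  open import Data.List using (List; []; _∷_; tabulate)
  open import Data.List.Relation.Binary.Permutation.Propositional as ↭ using (_↭_)
  open import Data.Maybe using (Maybe; just; nothing)
  open import Data.Maybe.Properties using (just-injective)
  open import Data.Nat as ℕ using (_≤_)
  open import Data.Product using (Σ-syntax; ∃-syntax; _×_; _,_; proj₁; proj₂)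
  open import Data.Unit using (⊤; tt)
  open import Function using (_∘_)
  open import Relation.Nullary using (¬_)
  open import Relation.Binary.PropositionalEquality using (_≡_; refl; sym; trans; cong; subst)
  open Separation

  -- U is the part of ℤ still to be covered; the sets are Boolean so that they can be halved.
  Covers : List ℕ → (ℤ → Set) → Set
  Covers []      U = ∀ n → ¬ U n
  Covers (a ∷ L) U = Σ[ S ∈ (ℤ → Bool) ] Separated a (λ n → S n ≡ true) × Covers L (λ n → U n × S n ≡ false)

  covers-⊆ : ∀ L {U V} → (∀ {n} → V n → U n) → Covers L U → Covers L V
  covers-⊆ []      V⊆U cov = λ n → cov n ∘ V⊆U
  covers-⊆ (a ∷ L) V⊆U (S , sep , cov) = S , sep , covers-⊆ L (λ (v , s) → V⊆U v , s) cov

  covers-swap : ∀ {a b L U} → Covers (a ∷ b ∷ L) U → Covers (b ∷ a ∷ L) U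
  covers-swap {L = L} (S , sepS , T , sepT , cov) =
    T , sepT , S , sepS , covers-⊆ L (λ ((u , t) , s) → (u , s) , t) cov

  covers-↭ : ∀ {L L′ U} → L ↭ L′ → Covers L U → Covers L′ U
  covers-↭ ↭.refl               cov             = cov
  covers-↭ (↭.prep a L↭L′)      (S , sep , cov) = S , sep , covers-↭ L↭L′ cov
  covers-↭ (↭.swap a b L↭L′)    cov             =
    let T , sepT , S , sepS , cov′ = covers-swap cov in T , sepT , S , sepS , covers-↭ L↭L′ cov′
  covers-↭ (↭.trans L↭L′ L′↭L″) cov             = covers-↭ L′↭L″ (covers-↭ L↭L′ cov)

  covers-∷ : ∀ {a L U} → Covers L U → Covers (a ∷ L) U
  covers-∷ {L = L} cov = (λ _ → false) , (λ _ _ ()) , covers-⊆ L proj₁ cov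

  covers-merge : ∀ {a b c L U} → a ≤ c ℕ.+ c → b ≤ c ℕ.+ c → Covers (c ∷ L) U → Covers (a ∷ b ∷ L) U
  covers-merge {L = L} a≤2c b≤2c (S , sep , cov) =
      half true  , separated-weaken a≤2c (half-separated sep true)
    , half false , separated-weaken b≤2c (half-separated sep false)
    , covers-⊆ L (λ {n} ((u , h₁) , h₀) → u , halves-cover n h₁ h₀) cov
    where open Halving S

  covers⇒family : ∀ {k} (a : Fin k → ℕ) {U} → Covers (tabulate a) U →
    Σ[ S ∈ (Fin k → ℤ → Set) ] (∀ i → Separated (a i) (S i)) × (∀ n → U n → ∃[ i ] S i n)
  covers⇒family {ℕ.zero}  a cov = (λ ()) , (λ ()) , λ n u → ⊥-elim (cov n u)
  covers⇒family {ℕ.suc k} a {U} (S₀ , sep₀ , cov) with covers⇒family (a ∘ suc) cov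
  ... | S , sep , cover = S′ , sep′ , cover′
    where
    S′ : Fin (ℕ.suc k) → ℤ → Set
    S′ zero    n = S₀ n ≡ true
    S′ (suc i) n = S i n
    sep′ : ∀ i → Separated (a i) (S′ i)
    sep′ zero    = sep₀
    sep′ (suc i) = sep i
    cover′ : ∀ n → U n → ∃[ i ] S′ i n
    cover′ n u with S₀ n in s
    ... | true  = zero , s
    ... | false = let i , si = cover n (u , s) in suc i , si

  covers⇒good : ∀ {k} (a : Fin k → ℕ) → Covers (tabulate a) (λ _ → ⊤) → Good a
  covers⇒good a cov = let S , sep , cover = covers⇒family a cov in S , sep , λ n → cover n tt

  isZero : ∀ {k} → Maybe (Fin (ℕ.suc k)) → Bool
  isZero (just zero) = true
  isZero _           = false

  isZero-sound : ∀ {k} {m : Maybe (Fin (ℕ.suc k))} → isZero m ≡ true → m ≡ just zero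
  isZero-sound {m = just zero} _ = refl

  shrink : ∀ {k} → Maybe (Fin (ℕ.suc k)) → Maybe (Fin k)
  shrink (just (suc i)) = just i
  shrink _              = nothing

  shrink-sound : ∀ {k} {m : Maybe (Fin (ℕ.suc k))} {i} → shrink m ≡ just i → m ≡ just (suc i)
  shrink-sound {m = just (suc i)} refl = refl

  -- Points coloured nothing are already covered by earlier sets.
  colouring⇒covers : ∀ {k} (a : Fin k → ℕ) {U} (colour : ℤ → Maybe (Fin k)) →
    (∀ i → Separated (a i) (λ n → colour n ≡ just i)) → (∀ n → U n → ∃[ i ] colour n ≡ just i) →
    Covers (tabulate a) U
  colouring⇒covers {ℕ.zero} a colour sep coloured n u with coloured n u
  ... | () , _
  colouring⇒covers {ℕ.suc k} a {U} colour sep coloured =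
      isZero ∘ colour
    , (λ m n zm zn → sep zero m n (isZero-sound zm) (isZero-sound zn))
    , colouring⇒covers (a ∘ suc) (shrink ∘ colour)
        (λ i m n sm sn → sep (suc i) m n (shrink-sound sm) (shrink-sound sn)) coloured′
    where
    coloured′ : ∀ n → U n × isZero (colour n) ≡ false → ∃[ i ] shrink (colour n) ≡ just i
    coloured′ n (u , nz) with coloured n u
    ... | suc i , c = i , cong shrink c
    ... | zero  , c with trans (sym (cong isZero c)) nz
    ...   | ()

  good⇒covers : ∀ {k} (a : Fin k → ℕ) {U} → Good a → Covers (tabulate a) U
  good⇒covers a (S , sep , cover) =
    colouring⇒covers a (just ∘ proj₁ ∘ cover)
      (λ i m n cm cn → sep i m n (member cm) (member cn)) (λ n _ → proj₁ (cover n) , refl)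
    where
    member : ∀ {i n} → just (proj₁ (cover n)) ≡ just i → S i n
    member {n = n} c = subst (λ j → S j n) (just-injective c) (proj₂ (cover n))

module Compression where
  open import Data.List using (List; []; _∷_)
  open import Data.List.Relation.Unary.All using (All; []; _∷_)
  open import Data.Nat as ℕ using (_≤_; _<_; _⊔_; _≤?_; ⌈_/2⌉)
  import Data.Nat.Properties as ℕ
  open import Data.Product using (_×_; _,_)
  open import Relation.Nullary using (yes; no)
  open import Relation.Binary.PropositionalEquality using (subst; sym)
  open Covering

  mergePairs : List ℕ → List ℕ
  mergePairs (a ∷ b ∷ L) = ⌈ a ⊔ b /2⌉ ∷ mergePairs L
  mergePairs _           = []

  -- Meant for sorted lists, where all entries after the first one above M are above M.
  compress : ℕ → List ℕ → List ℕ
  compress M []      = []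
  compress M (a ∷ L) with a ≤? M
  ... | yes _ = a ∷ compress M L
  ... | no  _ = mergePairs (a ∷ L)

  n≤⌈n/2⌉+⌈n/2⌉ : ∀ n → n ≤ ⌈ n /2⌉ ℕ.+ ⌈ n /2⌉
  n≤⌈n/2⌉+⌈n/2⌉ n = subst (_≤ ⌈ n /2⌉ ℕ.+ ⌈ n /2⌉) (ℕ.⌊n/2⌋+⌈n/2⌉≡n n) (ℕ.+-monoˡ-≤ ⌈ n /2⌉ (ℕ.⌊n/2⌋≤⌈n/2⌉ n))

  covers-mergePairs : ∀ L {U} → Covers (mergePairs L) U → Covers L U
  covers-mergePairs []          cov             = cov
  covers-mergePairs (a ∷ [])    cov             = covers-∷ cov
  covers-mergePairs (a ∷ b ∷ L) (S , sep , cov) =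
    covers-merge (ℕ.≤-trans (ℕ.m≤m⊔n a b) (n≤⌈n/2⌉+⌈n/2⌉ (a ⊔ b)))
                 (ℕ.≤-trans (ℕ.m≤n⊔m a b) (n≤⌈n/2⌉+⌈n/2⌉ (a ⊔ b)))
                 (S , sep , covers-mergePairs L cov)

  covers-compress : ∀ M L {U} → Covers (compress M L) U → Covers L U
  covers-compress M []      cov = cov
  covers-compress M (a ∷ L) cov with a ≤? M
  ... | yes _ = let S , sep , cov′ = cov in S , sep , covers-compress M L cov′
  ... | no  _ = covers-mergePairs (a ∷ L) cov

  1≤_≤_ : ℕ → ℕ → Set
  1≤ a ≤ B = 0 < a × a ≤ B

  mergePairs-bounded : ∀ M L → All (1≤_≤ (M ℕ.+ M)) L → All (1≤_≤ M) (mergePairs L)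
  mergePairs-bounded M []          _                                 = []
  mergePairs-bounded M (a ∷ [])    _                                 = []
  mergePairs-bounded M (a ∷ b ∷ L) ((0<a , a≤2M) ∷ (_ , b≤2M) ∷ bnd) =
    (ℕ.⌈n/2⌉-mono (ℕ.≤-trans 0<a (ℕ.m≤m⊔n a b)) ,
     subst (⌈ a ⊔ b /2⌉ ≤_) (sym (ℕ.n≡⌈n+n/2⌉ M)) (ℕ.⌈n/2⌉-mono (ℕ.⊔-lub a≤2M b≤2M)))
    ∷ mergePairs-bounded M L bnd

  compress-bounded : ∀ M L → All (1≤_≤ (M ℕ.+ M)) L → All (1≤_≤ M) (compress M L)
  compress-bounded M []      []                         = []
  compress-bounded M (a ∷ L) (a-bnd@(0<a , _) ∷ L-bnd) with a ≤? M
  ... | yes a≤M = (0<a , a≤M) ∷ compress-bounded M L L-bnd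
  ... | no  _   = mergePairs-bounded M (a ∷ L) (a-bnd ∷ L-bnd)

module Rationals where
  open import Data.Integer as ℤ using (+_; +≤+)
  import Data.Integer.Properties as ℤ
  open import Data.Fin as Fin using (Fin)
  open import Data.List using (List; foldr; map; tabulate)
  open import Data.List.Relation.Binary.Permutation.Propositional using (_↭_; ↭⇒↭ₛ)
  open import Data.List.Relation.Binary.Permutation.Propositional.Properties using (map⁺)
  open import Data.Nat as ℕ using (zero; suc; z≤n; _<_)
  import Data.Nat.Properties as ℕ
  open import Data.Rational using (ℚ; 0ℚ; _/_; _+_; _-_; -_; _*_; _≤_; toℚᵘ)
  open import Data.Rational.Solver using (module +-*-Solver)
  import Data.Rational.Properties as ℚ
  open import Data.Rational.Unnormalised as ℚᵘ using (mkℚᵘ; *≤*; *≡*)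
  import Data.Rational.Unnormalised.Properties as ℚᵘ
  open import Relation.Binary.PropositionalEquality using (_≡_; refl; sym; cong; subst₂; setoid)
  open import Data.List.Relation.Binary.Permutation.Setoid.Properties (setoid ℚ) using (foldr-commMonoid)

  toℚᵘ-/ : ∀ m n → toℚᵘ (+ m / suc n) ℚᵘ.≃ mkℚᵘ (+ m) n
  toℚᵘ-/ m n = ℚ.toℚᵘ-fromℚᵘ (mkℚᵘ (+ m) n)

  fraction-≤ : ∀ m n p q → m ℕ.* suc q ℕ.≤ p ℕ.* suc n → + m / suc n ≤ + p / suc q
  fraction-≤ m n p q mq≤pn = ℚ.toℚᵘ-cancel-≤
    (ℚᵘ.≤-respˡ-≃ (ℚᵘ.≃-sym (toℚᵘ-/ m n)) (ℚᵘ.≤-respʳ-≃ (ℚᵘ.≃-sym (toℚᵘ-/ p q))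
      (*≤* (subst₂ ℤ._≤_ (ℤ.pos-* m (suc q)) (ℤ.pos-* p (suc n)) (+≤+ mq≤pn)))))

  fraction-* : ∀ m n p q → (+ m / suc n) * (+ p / suc q) ≡ + (m ℕ.* p) / (suc n ℕ.* suc q)
  fraction-* m n p q = ℚ.toℚᵘ-injective (begin
    toℚᵘ ((+ m / suc n) * (+ p / suc q))           ≈⟨ ℚ.toℚᵘ-homo-* (+ m / suc n) (+ p / suc q) ⟩
    toℚᵘ (+ m / suc n) ℚᵘ.* toℚᵘ (+ p / suc q)    ≈⟨ ℚᵘ.*-cong (toℚᵘ-/ m n) (toℚᵘ-/ p q) ⟩
    mkℚᵘ (+ m) n ℚᵘ.* mkℚᵘ (+ p) q                ≈⟨ *≡* (cong (ℤ._* + suc (q ℕ.+ n ℕ.* suc q)) (sym (ℤ.pos-* m p))) ⟩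
    mkℚᵘ (+ (m ℕ.* p)) (q ℕ.+ n ℕ.* suc q)        ≈⟨ toℚᵘ-/ (m ℕ.* p) (q ℕ.+ n ℕ.* suc q) ⟨
    toℚᵘ (+ (m ℕ.* p) / (suc n ℕ.* suc q))        ∎)
    where open ℚᵘ.≃-Reasoning

  fraction-nonNeg : ∀ m n → 0ℚ ≤ + m / suc n
  fraction-nonNeg m n = fraction-≤ 0 0 m n z≤n

  recip-nonNeg : ∀ n → 0ℚ ≤ recip n
  recip-nonNeg zero    = ℚ.≤-refl
  recip-nonNeg (suc n) = fraction-nonNeg 1 n

  recip-antitone : ∀ {m n} → 0 < m → m ℕ.≤ n → recip n ≤ recip m
  recip-antitone {suc m} {suc n} _ m≤n = fraction-≤ 1 n 1 m (ℕ.*-monoʳ-≤ 1 m≤n)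

  ∑recip : List ℕ → ℚ
  ∑recip L = foldr _+_ 0ℚ (map recip L)

  ∑recip-↭ : ∀ {L L′} → L ↭ L′ → ∑recip L ≡ ∑recip L′
  ∑recip-↭ L↭L′ = foldr-commMonoid ℚ.+-0-isCommutativeMonoid (↭⇒↭ₛ (map⁺ recip L↭L′))

  recipSum≡∑recip∘tabulate : ∀ {k} (a : Fin k → ℕ) → recipSum a ≡ ∑recip (tabulate a)
  recipSum≡∑recip∘tabulate {zero}  a = refl
  recipSum≡∑recip∘tabulate {suc k} a =
    cong (λ s → recip (a Fin.zero) + s) (recipSum≡∑recip∘tabulate (λ i → a (Fin.suc i)))

  p≤q+r⇒p-r≤q : ∀ {p q r} → p ≤ q + r → p - r ≤ q
  p≤q+r⇒p-r≤q {p} {q} {r} p≤q+r = begin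
    p - r        ≤⟨ ℚ.+-monoˡ-≤ (- r) p≤q+r ⟩
    q + r - r    ≡⟨ solve 2 (λ q r → q :+ r :- r := q) refl q r ⟩
    q            ∎
    where
    open ℚ.≤-Reasoning
    open +-*-Solver

module Weights (M : ℕ) where
  open import Data.Integer using (+_)
  open import Data.List using ([]; _∷_)
  open import Data.List.Relation.Unary.Linked as Linked using (Linked; _∷_)
  open import Data.Nat as ℕ using (suc; z≤n; s≤s; _<_; _⊔_; _≤?_; ⌈_/2⌉; ⌊_/2⌋)
  import Data.Nat.Properties as ℕ
  open import Data.Nat.Solver using (module +-*-Solver)
  open import Data.Rational using (ℚ; 0ℚ; 1ℚ; _/_; _+_; _*_; _≤_; NonNegative; nonNegative)
  import Data.Rational.Properties as ℚ
  open import Data.Rational.Solver renaming (module +-*-Solver to ℚ-Solver)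
  open import Relation.Nullary using (yes; no)
  open import Relation.Binary.PropositionalEquality using (_≡_; refl; sym; trans; cong; subst)
  open Rationals
  open Compression

  θ δ : ℚ
  θ = + suc M / suc (suc M)
  δ = + 1 / suc (suc M)

  instance
    θ-nonNeg : NonNegative θ
    θ-nonNeg = ℚ.normalize-nonNeg (suc M) (suc (suc M))

  θ≤1 : θ ≤ 1ℚ
  θ≤1 = fraction-≤ (suc M) (suc M) 1 0 (begin
    suc M ℕ.* 1         ≡⟨ ℕ.*-identityʳ (suc M) ⟩
    suc M               <⟨ ℕ.n<1+n (suc M) ⟩
    suc (suc M)         ≡⟨ ℕ.*-identityˡ (suc (suc M)) ⟨
    1 ℕ.* suc (suc M)   ∎)
    where open ℕ.≤-Reasoning

  θ*r≤r : ∀ {r} → 0ℚ ≤ r → θ * r ≤ r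
  θ*r≤r {r} 0≤r = begin
    θ * r    ≤⟨ ℚ.*-monoʳ-≤-nonNeg r {{nonNegative 0≤r}} θ≤1 ⟩
    1ℚ * r   ≡⟨ ℚ.*-identityˡ r ⟩
    r        ∎
    where open ℚ.≤-Reasoning

  θ*recip[1+n]≡[1+M]/[2+M][1+n] : ∀ n → θ * recip (suc n) ≡ + suc M / (suc (suc M) ℕ.* suc n)
  θ*recip[1+n]≡[1+M]/[2+M][1+n] n = trans (fraction-* (suc M) (suc M) 1 n)
                         (cong (λ m → + m / (suc (suc M) ℕ.* suc n)) (ℕ.*-identityʳ (suc M)))

  θ*recip-nonNeg : ∀ n → 0ℚ ≤ θ * recip n
  θ*recip-nonNeg n = subst (_≤ θ * recip n) (ℚ.*-zeroʳ θ) (ℚ.*-monoˡ-≤-nonNeg θ (recip-nonNeg n))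

  θ*recip-antitone : ∀ {m n} → 0 < m → m ℕ.≤ n → θ * recip n ≤ θ * recip m
  θ*recip-antitone 0<m m≤n = ℚ.*-monoˡ-≤-nonNeg θ (recip-antitone 0<m m≤n)

  θ*recip[1+M]≤δ : θ * recip (suc M) ≤ δ
  θ*recip[1+M]≤δ = subst (_≤ δ) (sym (θ*recip[1+n]≡[1+M]/[2+M][1+n] M))
    (fraction-≤ (suc M) (M ℕ.+ suc M ℕ.* suc M) 1 (suc M) (ℕ.≤-reflexive (trans (ℕ.*-comm (suc M) (suc (suc M))) (sym (ℕ.*-identityˡ _)))))

  2[1+M]⌈n/2⌉≤[2+M]n : ∀ {n} → M < n → 2 ℕ.* suc M ℕ.* ⌈ n /2⌉ ℕ.≤ suc (suc M) ℕ.* n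
  2[1+M]⌈n/2⌉≤[2+M]n {suc n} (s≤s M≤n) = begin
    2 ℕ.* m ℕ.* suc c            ≡⟨ solve 2 (λ m c → con 2 :* m :* (con 1 :+ c) := m :* (con 2 :+ (c :+ c))) refl m c ⟩
    m ℕ.* (2 ℕ.+ (c ℕ.+ c))      ≤⟨ ℕ.*-monoʳ-≤ m (s≤s (s≤s c+c≤n)) ⟩
    m ℕ.* (2 ℕ.+ n)              ≡⟨ solve 2 (λ m n → m :* (con 2 :+ n) := m :* (con 1 :+ n) :+ m) refl m n ⟩
    m ℕ.* suc n ℕ.+ m            ≤⟨ ℕ.+-monoʳ-≤ (m ℕ.* suc n) (s≤s M≤n) ⟩
    m ℕ.* suc n ℕ.+ suc n        ≡⟨ solve 2 (λ m n → m :* (con 1 :+ n) :+ (con 1 :+ n) := (con 1 :+ m) :* (con 1 :+ n)) refl m n ⟩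
    suc m ℕ.* suc n              ∎
    where
    open ℕ.≤-Reasoning
    open +-*-Solver
    m = suc M
    c = ⌊ n /2⌋
    c+c≤n : c ℕ.+ c ℕ.≤ n
    c+c≤n = subst (c ℕ.+ c ℕ.≤_) (ℕ.⌊n/2⌋+⌈n/2⌉≡n n) (ℕ.+-monoʳ-≤ c (ℕ.⌊n/2⌋≤⌈n/2⌉ n))

  θ*recip[n]+θ*recip[n]≤recip⌈n/2⌉ : ∀ {n} → M < n → θ * recip n + θ * recip n ≤ recip ⌈ n /2⌉
  θ*recip[n]+θ*recip[n]≤recip⌈n/2⌉ {suc n} (s≤s M≤n) = begin
    θ * recip (suc n) + θ * recip (suc n)                 ≡⟨ p+p≡2*p (θ * recip (suc n)) ⟩
    (+ 2 / 1) * (θ * recip (suc n))                       ≡⟨ cong ((+ 2 / 1) *_) (θ*recip[1+n]≡[1+M]/[2+M][1+n] n) ⟩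
    (+ 2 / 1) * (+ suc M / (suc (suc M) ℕ.* suc n))      ≡⟨ fraction-* 2 0 (suc M) _ ⟩
    + (2 ℕ.* suc M) / (1 ℕ.* (suc (suc M) ℕ.* suc n))    ≤⟨ fraction-≤ (2 ℕ.* suc M) _ 1 c cross-multiplied ⟩
    recip (suc c)                                         ∎
    where
    open ℚ.≤-Reasoning
    c = ⌊ n /2⌋
    p+p≡2*p : ∀ p → p + p ≡ (+ 2 / 1) * p
    p+p≡2*p = solve 1 (λ p → p :+ p := con (+ 2 / 1) :* p) refl
      where open ℚ-Solver
    cross-multiplied : (2 ℕ.* suc M) ℕ.* suc c ℕ.≤ 1 ℕ.* (1 ℕ.* (suc (suc M) ℕ.* suc n))
    cross-multiplied = subst ((2 ℕ.* suc M) ℕ.* suc c ℕ.≤_)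
      (sym (trans (ℕ.*-identityˡ _) (ℕ.*-identityˡ _))) (2[1+M]⌈n/2⌉≤[2+M]n (s≤s M≤n))

  mergePairs-bound : ∀ {m} L → M < m → Linked ℕ._≤_ (m ∷ L) →
                     θ * ∑recip L ≤ ∑recip (mergePairs L) + θ * recip m
  mergePairs-bound {m} [] M<m _ = begin
    θ * 0ℚ              ≡⟨ ℚ.*-zeroʳ θ ⟩
    0ℚ                  ≤⟨ θ*recip-nonNeg m ⟩
    θ * recip m         ≡⟨ ℚ.+-identityˡ _ ⟨
    0ℚ + θ * recip m    ∎
    where open ℚ.≤-Reasoning
  mergePairs-bound {m} (a ∷ []) M<m (m≤a ∷ _) = begin
    θ * (recip a + 0ℚ)  ≡⟨ cong (θ *_) (ℚ.+-identityʳ (recip a)) ⟩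
    θ * recip a         ≤⟨ θ*recip-antitone (ℕ.<-≤-trans (s≤s z≤n) M<m) m≤a ⟩
    θ * recip m         ≡⟨ ℚ.+-identityˡ _ ⟨
    0ℚ + θ * recip m    ∎
    where open ℚ.≤-Reasoning
  mergePairs-bound {m} (a ∷ b ∷ L) M<m (m≤a ∷ a≤b ∷ sorted) = begin
    θ * (recip a + (recip b + ∑recip L))                  ≡⟨ distrib θ (recip a) (recip b) (∑recip L) ⟩
    θ * recip a + (θ * recip b + θ * ∑recip L)            ≤⟨ ℚ.+-mono-≤ (θ*recip-antitone 0<m m≤a)
                                                               (ℚ.+-monoʳ-≤ (θ * recip b) (mergePairs-bound L M<b sorted)) ⟩
    θ * recip m + (θ * recip b + (P + θ * recip b))       ≡⟨ regroup (θ * recip m) (θ * recip b) P ⟩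
    (θ * recip b + θ * recip b) + P + θ * recip m         ≤⟨ ℚ.+-monoˡ-≤ _ (ℚ.+-monoˡ-≤ P (θ*recip[n]+θ*recip[n]≤recip⌈n/2⌉ M<b)) ⟩
    recip ⌈ b /2⌉ + P + θ * recip m                       ≡⟨ cong (λ c → recip ⌈ c /2⌉ + P + θ * recip m) (ℕ.m≤n⇒m⊔n≡n a≤b) ⟨
    recip ⌈ a ⊔ b /2⌉ + P + θ * recip m                   ∎
    where
    open ℚ.≤-Reasoning
    open ℚ-Solver
    P = ∑recip (mergePairs L)
    0<m = ℕ.<-≤-trans (s≤s z≤n) M<m
    M<b = ℕ.<-≤-trans M<m (ℕ.≤-trans m≤a a≤b)
    distrib : ∀ t x y z → t * (x + (y + z)) ≡ t * x + (t * y + t * z)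
    distrib = solve 4 (λ t x y z → t :* (x :+ (y :+ z)) := t :* x :+ (t :* y :+ t :* z)) refl
    regroup : ∀ x y p → x + (y + (p + y)) ≡ (y + y) + p + x
    regroup = solve 3 (λ x y p → x :+ (y :+ (p :+ y)) := (y :+ y) :+ p :+ x) refl

  compress-bound : ∀ L → Linked ℕ._≤_ L → θ * ∑recip L ≤ ∑recip (compress M L) + δ
  compress-bound [] _ = begin
    θ * 0ℚ    ≡⟨ ℚ.*-zeroʳ θ ⟩
    0ℚ        ≤⟨ fraction-nonNeg 1 (suc M) ⟩
    δ         ≡⟨ ℚ.+-identityˡ δ ⟨
    0ℚ + δ    ∎
    where open ℚ.≤-Reasoning
  compress-bound (a ∷ L) sorted with a ≤? M
  ... | yes _ = begin
    θ * (recip a + ∑recip L)                ≡⟨ ℚ.*-distribˡ-+ θ (recip a) (∑recip L) ⟩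
    θ * recip a + θ * ∑recip L              ≤⟨ ℚ.+-mono-≤ (θ*r≤r (recip-nonNeg a)) (compress-bound L (Linked.tail sorted)) ⟩
    recip a + (∑recip (compress M L) + δ)   ≡⟨ ℚ.+-assoc (recip a) _ δ ⟨
    recip a + ∑recip (compress M L) + δ     ∎
    where open ℚ.≤-Reasoning
  ... | no a≰M = ℚ.≤-trans (mergePairs-bound (a ∷ L) (ℕ.n<1+n M) (ℕ.≰⇒> a≰M ∷ sorted))
                           (ℚ.+-monoʳ-≤ (∑recip (mergePairs (a ∷ L))) θ*recip[1+M]≤δ)

open import Data.Nat using (suc; _≤_; _<_; _*_)
open import Data.Integer using (+_)
open import Data.Fin using (Fin)
open import Data.Product using (Σ; _×_; _,_; proj₁; proj₂)
open import Data.Rational using (_/_) renaming (_*_ to _*ℚ_; _-_ to _-ℚ_; _≤_ to _≤ℚ_; _+_ to _+ℚ_)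
open import Data.List using (tabulate; lookup; length)
open import Data.List.Properties using (tabulate-lookup)
open import Data.List.Membership.Propositional.Properties using (∈-lookup)
open import Data.List.Relation.Unary.All as All using (All)
open import Data.List.Relation.Unary.All.Properties using (tabulate⁺)
open import Data.List.Relation.Binary.Permutation.Propositional using (↭-sym)
open import Data.List.Relation.Binary.Permutation.Propositional.Properties using (All-resp-↭)
import Data.Nat as ℕ
import Data.Nat.Properties as ℕ
open import Function using (_∘_)
open import Data.List.Sort ℕ.≤-decTotalOrder using (sort; sort-↭; sort-↗)
open import Relation.Binary.PropositionalEquality using (sym; trans; cong; subst; subst₂)
open Covering
open Compression
open Rationals

lemma6 : (M : ℕ) → 0 < M → (k : ℕ) → (a : Fin k → ℕ) →
    (∀ i → 0 < a i) → Bad a → (∀ i → a i ≤ 2 * M) →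
    Σ ℕ λ m → Σ (Fin m → ℕ) λ b →
      (∀ i → 0 < b i) × Bad b × (∀ i → b i ≤ M) ×
      ((((+ suc M) / suc (suc M)) *ℚ recipSum a) -ℚ ((+ 1) / suc (suc M)) ≤ℚ recipSum b)
lemma6 M _ k a a-pos a-bad a≤2M =
  length B , lookup B , proj₁ ∘ B-bounded , B-bad , proj₂ ∘ B-bounded , p≤q+r⇒p-r≤q weight-bound
  where
  open Weights M
  L = sort (tabulate a)
  B = compress M L
  L-bounded : All (1≤_≤ (M ℕ.+ M)) L
  L-bounded = All-resp-↭ (↭-sym (sort-↭ (tabulate a)))
                (tabulate⁺ λ i → a-pos i , subst (a i ≤_) (cong (M ℕ.+_) (ℕ.+-identityʳ M)) (a≤2M i))
  B-bounded : ∀ i → 1≤ lookup B i ≤ M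
  B-bounded i = All.lookup (compress-bounded M L L-bounded) (∈-lookup i)
  B-bad : Bad (lookup B)
  B-bad B-good = a-bad (covers⇒good a (covers-↭ (sort-↭ (tabulate a)) (covers-compress M L
                   (subst (λ X → Covers X _) (tabulate-lookup B) (good⇒covers (lookup B) B-good)))))
  weight-bound : θ *ℚ recipSum a ≤ℚ recipSum (lookup B) +ℚ δ
  weight-bound = subst₂ (λ x y → θ *ℚ x ≤ℚ y +ℚ δ)
    (sym (trans (recipSum≡∑recip∘tabulate a) (∑recip-↭ (↭-sym (sort-↭ (tabulate a))))))
    (sym (trans (recipSum≡∑recip∘tabulate (lookup B)) (cong ∑recip (tabulate-lookup B))))
    (compress-bound L (sort-↗ (tabulate a)))
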